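{- Let $n,d_1,d_2$ be positive integers. If there exist a regular SMS$(n,d_1)$ and an SAMS$(n,d_2)$ which are compatible, then there exists an SAMS$(n,d_1+d_2)$.
   Context: For positive integers $n,d$ with $d<n$: an $n\times n$ array with entries in $\{0,1,\dots,nd\}$ in which each element of $\{1,\dots,nd\}$ occurs in exactly one entry (all other entries $0$) is a sparse magic square SMS$(n,d)$ if all row-sums, column-sums and the two main diagonal sums (entries $(i,i)$, resp. $(i,n+1-i)$) are equal; it is a sparse anti-magic square SAMS$(n,d)$ if these $2n+2$ sums form a set of $2n+2$ consecutive integers. Such a square is regular if every row, every column and both main diagonals contain exactly $d$ positive entries. For an $m\times n$ array $M=(m_{i,j})$ let $\Omega(M)=\{(i,j): m_{i,j}\neq 0\}$; two $m\times n$ arrays $M,N$ are compatible if $\Omega(M)\cap\Omega(N)=\emptyset$. -}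

module Defs where

open import Data.Nat using (ℕ; zero; suc; _+_; _*_; _≤_; _<_; _≟_)
open import Data.Fin using (Fin; opposite)
open import Data.Vec using (Vec; tabulate; sum; count)
open import Data.Product using (_×_; Σ; ∃; ∃-syntax; _,_)
open import Relation.Nullary using (¬_; ¬?)
open import Relation.Binary.PropositionalEquality using (_≡_; _≢_)

Array : ℕ → Set
Array n = Fin n → Fin n → ℕ

Pos : ℕ → Set
Pos n = Fin n × Fin n

entry : ∀ {n} → Array n → Pos n → ℕ
entry M (i , j) = M i j

IsSparseFilling : (n d : ℕ) → Array n → Set
IsSparseFilling n d M =
  (∀ i j → M i j ≤ n * d) ×
  (∀ k → 1 ≤ k → k ≤ n * d →
     Σ (Pos n) λ p → entry M p ≡ k × (∀ q → entry M q ≡ k → q ≡ p))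

-- The 2n+2 lines: n rows, n columns, main diagonal (i,i) and
-- anti-diagonal (i, n+1-i)  [0-indexed: (i, opposite i)].
data Line (n : ℕ) : Set where
  row  : Fin n → Line n
  col  : Fin n → Line n
  diag : Line n
  anti : Line n

lineEntries : ∀ {n} → Array n → Line n → Vec ℕ n
lineEntries M (row i) = tabulate (λ j → M i j)
lineEntries M (col j) = tabulate (λ i → M i j)
lineEntries M diag    = tabulate (λ i → M i i)
lineEntries M anti    = tabulate (λ i → M i (opposite i))

lineSum : ∀ {n} → Array n → Line n → ℕ
lineSum M ℓ = sum (lineEntries M ℓ)

positives : ∀ {n} → Array n → Line n → ℕ
positives M ℓ = count (λ x → ¬? (x ≟ 0)) (lineEntries M ℓ)

IsSMS : (n d : ℕ) → Array n → Set
IsSMS n d M = IsSparseFilling n d M × ∃[ s ] (∀ ℓ → lineSum M ℓ ≡ s)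

IsSAMS : (n d : ℕ) → Array n → Set
IsSAMS n d M = IsSparseFilling n d M ×
  ∃[ a ] ((∀ ℓ → a ≤ lineSum M ℓ × lineSum M ℓ < a + (2 * n + 2)) ×
          (∀ k → k < 2 * n + 2 → ∃[ ℓ ] lineSum M ℓ ≡ a + k))

IsRegular : (n d : ℕ) → Array n → Set
IsRegular n d M = ∀ ℓ → positives M ℓ ≡ d

_∈Ω_ : ∀ {n} → Pos n → Array n → Set
p ∈Ω M = entry M p ≢ 0

Compatible : ∀ {n} → Array n → Array n → Set
Compatible M N = ∀ p → ¬ (p ∈Ω M × p ∈Ω N)

module Submission where

open import Defs
open import Data.Nat using (ℕ; zero; suc; _+_; _*_; _∸_; _≤_; _<_; _≟_; _≤?_; s≤s; z<s)
open import Data.Nat.Properties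
open import Data.Fin using (Fin; opposite) renaming (zero to fz; suc to fs)
open import Data.Vec using (Vec; _∷_; tabulate; sum; count)
open import Data.Product using (_×_; ∃-syntax; _,_; Σ)
open import Data.Sum using (_⊎_; inj₁; inj₂)
open import Function using (id; _∘_)
open import Function.Bundles using (_⇔_; mk⇔; Equivalence)
open import Relation.Nullary using (¬?; yes; no; contradiction)
open import Relation.Binary.PropositionalEquality
open import Data.Nat.Solver using (module +-*-Solver)
open +-*-Solver

-- With c = n d₂, put P = M' + N where M' adds c to every positive
-- entry of M.  Compatibility keeps the supports apart, so P takes the values
-- 1..c exactly where N does and c+1..c+nd₁ exactly where M does.  Since M is
-- regular, every line of M' gains c d₁ over M, and M is magic, so every line
-- sum of P is that of N shifted by the same constant: the anti-magic property
-- of N carries over to P.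

raise : ℕ → ℕ → ℕ
raise c zero    = zero
raise c (suc m) = suc m + c

merge : ∀ {n} → ℕ → Array n → Array n → Array n
merge c M N i j = raise c (M i j) + N i j

compatible⇒disjoint : ∀ {n} {M N : Array n} → Compatible M N →
  ∀ p → entry M p ≡ 0 ⊎ entry N p ≡ 0
compatible⇒disjoint {M = M} {N} compat p with entry M p in eqM | entry N p in eqN
... | zero  | _     = inj₁ refl
... | suc _ | zero  = inj₂ refl
... | suc _ | suc _ = contradiction ((λ e → 0≢1+n (trans (sym e) eqM)) ,
                                     (λ e → 0≢1+n (trans (sym e) eqN))) (compat p)

raise+-≤ : ∀ {c A m x} → m ≤ A → x ≤ c → m ≡ 0 ⊎ x ≡ 0 → raise c m + x ≤ A + c
raise+-≤ {c} {A} {zero}  _   x≤c _           = ≤-trans x≤c (m≤n+m c A)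
raise+-≤ {c} {A} {suc m} m≤A _   (inj₂ refl) =
  subst (_≤ A + c) (sym (+-identityʳ (suc m + c))) (+-monoˡ-≤ c m≤A)

raise+≡-low : ∀ {c k m x} → 1 ≤ k → k ≤ c → m ≡ 0 ⊎ x ≡ 0 →
  (raise c m + x ≡ k) ⇔ (x ≡ k)
raise+≡-low {m = zero} _ _ _ = mk⇔ id id
raise+≡-low {c} {k} {suc m} 1≤k k≤c (inj₂ refl) =
  mk⇔ too-big (λ 0≡k → contradiction (sym 0≡k) (m<n⇒n≢0 1≤k))
  where
  too-big : suc m + c + 0 ≡ k → 0 ≡ k
  too-big e = contradiction (≤-trans (m<n+m c z<s) (≤-reflexive (trans (sym (+-identityʳ _)) e)))
                            (≤⇒≯ k≤c)

raise+≡-high : ∀ {c k m x} → 1 ≤ k → x ≤ c → m ≡ 0 ⊎ x ≡ 0 →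
  (raise c m + x ≡ k + c) ⇔ (m ≡ k)
raise+≡-high {c} {k} {zero} {x} (s≤s _) x≤c _ = mk⇔ too-small (λ ())
  where
  too-small : x ≡ k + c → 0 ≡ k
  too-small e = contradiction (≤-trans (≤-reflexive (sym e)) x≤c) (<⇒≱ (m<n+m c z<s))
raise+≡-high {c} {k} {suc m} _ _ (inj₂ refl) =
  mk⇔ (λ e → +-cancelʳ-≡ c (suc m) k (trans (sym (+-identityʳ _)) e))
      (λ e → trans (+-identityʳ _) (cong (_+ c) e))

UniqueOccurrence : ∀ {n} → Array n → ℕ → Set
UniqueOccurrence {n} M k = Σ (Pos n) λ p → entry M p ≡ k × (∀ q → entry M q ≡ k → q ≡ p)

uniqueOccurrence-transfer : ∀ {n} {A B : Array n} {a b} →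
  (∀ q → (entry A q ≡ a) ⇔ (entry B q ≡ b)) →
  UniqueOccurrence B b → UniqueOccurrence A a
uniqueOccurrence-transfer A⇔B (p , Bp , unique) =
  p , Equivalence.from (A⇔B p) Bp , λ q Aq → unique q (Equivalence.to (A⇔B q) Aq)

merge-isSparseFilling : ∀ {n d₁ d₂} {M N : Array n} →
  IsSparseFilling n d₁ M → IsSparseFilling n d₂ N → Compatible M N →
  IsSparseFilling n (d₁ + d₂) (merge (n * d₂) M N)
merge-isSparseFilling {n} {d₁} {d₂} {M} {N} (M≤ , M-occ) (N≤ , N-occ) compat =
  bounded , occurs
  where
  c : ℕ
  c = n * d₂
  disjoint : ∀ p → entry M p ≡ 0 ⊎ entry N p ≡ 0
  disjoint = compatible⇒disjoint compat
  nd-split : n * (d₁ + d₂) ≡ n * d₁ + c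
  nd-split = *-distribˡ-+ n d₁ d₂

  bounded : ∀ i j → merge c M N i j ≤ n * (d₁ + d₂)
  bounded i j = subst (merge c M N i j ≤_) (sym nd-split)
                      (raise+-≤ (M≤ i j) (N≤ i j) (disjoint (i , j)))

  occurs : ∀ k → 1 ≤ k → k ≤ n * (d₁ + d₂) → UniqueOccurrence (merge c M N) k
  occurs k 1≤k k≤ with k ≤? c
  ... | yes k≤c =
    uniqueOccurrence-transfer (λ q → raise+≡-low 1≤k k≤c (disjoint q)) (N-occ k 1≤k k≤c)
  ... | no k≰c =
    subst (UniqueOccurrence (merge c M N)) (m∸n+n≡m c≤k)
      (uniqueOccurrence-transfer
        (λ q@(i , j) → raise+≡-high 1≤k∸c (N≤ i j) (disjoint q))
        (M-occ (k ∸ c) 1≤k∸c k∸c≤))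
    where
    c<k : c < k
    c<k = ≰⇒> k≰c
    c≤k : c ≤ k
    c≤k = <⇒≤ c<k
    1≤k∸c : 1 ≤ k ∸ c
    1≤k∸c = m<n⇒0<n∸m c<k
    k∸c≤ : k ∸ c ≤ n * d₁
    k∸c≤ = subst (k ∸ c ≤_) (trans (cong (_∸ c) nd-split) (m+n∸n≡m (n * d₁) c))
                 (∸-monoˡ-≤ c k≤)

nonzeros : ∀ {n} → Vec ℕ n → ℕ
nonzeros = count (λ x → ¬? (x ≟ 0))

raise+-cons : ∀ {n} c m x (xs ys : Vec ℕ n) →
  raise c m + x + (sum xs + c * nonzeros xs + sum ys)
    ≡ sum (m ∷ xs) + c * nonzeros (m ∷ xs) + sum (x ∷ ys)
raise+-cons c zero x xs ys =
  solve 4 (λ x S cK T → x :+ (S :+ cK :+ T) := S :+ cK :+ (x :+ T))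
    refl x (sum xs) (c * nonzeros xs) (sum ys)
raise+-cons c (suc m) x xs ys = begin
  suc m + c + x + (S + c * K + T)      ≡⟨ solve 6 (λ m c' x S cK T → m :+ c' :+ x :+ (S :+ cK :+ T)
                                                                 := m :+ S :+ (c' :+ cK) :+ (x :+ T))
                                            refl (suc m) c x S (c * K) T ⟩
  suc m + S + (c + c * K) + (x + T)    ≡⟨ cong (λ y → suc m + S + y + (x + T)) (sym (*-suc c K)) ⟩
  suc m + S + c * suc K + (x + T)      ∎
  where
  open ≡-Reasoning
  S K T : ℕ
  S = sum xs
  K = nonzeros xs
  T = sum ys

sum-tabulate-raise+ : ∀ {n} c (f g : Fin n → ℕ) →
  sum (tabulate (λ i → raise c (f i) + g i))
    ≡ sum (tabulate f) + c * nonzeros (tabulate f) + sum (tabulate g)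
sum-tabulate-raise+ {zero}  c f g = cong (_+ 0) (sym (*-zeroʳ c))
sum-tabulate-raise+ {suc n} c f g =
  trans (cong (raise c (f fz) + g fz +_) (sum-tabulate-raise+ c (f ∘ fs) (g ∘ fs)))
        (raise+-cons c (f fz) (g fz) (tabulate (f ∘ fs)) (tabulate (g ∘ fs)))

lineSum-merge : ∀ {n} c (M N : Array n) ℓ →
  lineSum (merge c M N) ℓ ≡ lineSum M ℓ + c * positives M ℓ + lineSum N ℓ
lineSum-merge c M N (row i) = sum-tabulate-raise+ c (M i) (N i)
lineSum-merge c M N (col j) = sum-tabulate-raise+ c (λ i → M i j) (λ i → N i j)
lineSum-merge c M N diag    = sum-tabulate-raise+ c (λ i → M i i) (λ i → N i i)
lineSum-merge c M N anti    =
  sum-tabulate-raise+ c (λ i → M i (opposite i)) (λ i → N i (opposite i))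

ConsecutiveLineSums : ∀ {n} → Array n → ℕ → Set
ConsecutiveLineSums {n} M a =
  (∀ ℓ → a ≤ lineSum M ℓ × lineSum M ℓ < a + (2 * n + 2)) ×
  (∀ k → k < 2 * n + 2 → ∃[ ℓ ] lineSum M ℓ ≡ a + k)

consecutiveLineSums-shift : ∀ {n} {P N : Array n} {t a} →
  (∀ ℓ → lineSum P ℓ ≡ t + lineSum N ℓ) →
  ConsecutiveLineSums N a → ConsecutiveLineSums P (t + a)
consecutiveLineSums-shift {n} {P} {N} {t} {a} shifted (range , hits) = range′ , hits′
  where
  range′ : ∀ ℓ → t + a ≤ lineSum P ℓ × lineSum P ℓ < t + a + (2 * n + 2)
  range′ ℓ with range ℓ
  ... | a≤ , <a+ rewrite shifted ℓ | +-assoc t a (2 * n + 2) =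
    +-monoʳ-≤ t a≤ , +-monoʳ-< t <a+
  hits′ : ∀ k → k < 2 * n + 2 → ∃[ ℓ ] lineSum P ℓ ≡ t + a + k
  hits′ k k< with hits k k<
  ... | ℓ , Nℓ≡ = ℓ , trans (shifted ℓ) (trans (cong (t +_) Nℓ≡) (sym (+-assoc t a k)))

lemma4p2 : (n d₁ d₂ : ℕ) → 1 ≤ n → 1 ≤ d₁ → 1 ≤ d₂ → d₁ < n → d₂ < n →
    (∃[ M ] ∃[ N ] (IsSMS n d₁ M × IsRegular n d₁ M × IsSAMS n d₂ N × Compatible M N)) →
    ∃[ P ] IsSAMS n (d₁ + d₂) P
lemma4p2 n d₁ d₂ _ _ _ _ _
  (M , N , (M-fill , s , M-magic) , M-regular , (N-fill , a , N-sums) , compat) =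
  merge c M N , merge-isSparseFilling M-fill N-fill compat ,
  s + c * d₁ + a , consecutiveLineSums-shift lineSum-shifted N-sums
  where
  c : ℕ
  c = n * d₂
  lineSum-shifted : ∀ ℓ → lineSum (merge c M N) ℓ ≡ s + c * d₁ + lineSum N ℓ
  lineSum-shifted ℓ =
    trans (lineSum-merge c M N ℓ)
          (cong₂ (λ x y → x + c * y + lineSum N ℓ) (M-magic ℓ) (M-regular ℓ))
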